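{- Let $\mathbb{M}=(\mathbb{G},\mathcal{X},\phi,f)$ be an MRF with $\phi_v(x)>0$ and $f_{v,u}(x,y)>0$ for all nodes, edges and $x,y\in\mathcal{X}$. Let $v$ be a node with neighbors $v_1,\dots,v_m$. Then for every $x_0\in\mathcal{X}$, $$\mathbb{P}_{\mathbb{M}}(X_v=x_0)=\frac{\phi_v(x_0)\sum_{x_1,\dots,x_m\in\mathcal{X}}\prod_{k=1}^m f_{v,v_k}(x_0,x_k)\,\mathbb{P}_{\mathbb{M}_v[v_1,x_1;\dots;v_{k-1},x_{k-1}]}(X_{v_k}=x_k)}{\sum_{x\in\mathcal{X}}\phi_v(x)\sum_{x_1,\dots,x_m\in\mathcal{X}}\prod_{k=1}^m f_{v,v_k}(x,x_k)\,\mathbb{P}_{\mathbb{M}_v[v_1,x_1;\dots;v_{k-1},x_{k-1}]}(X_{v_k}=x_k)},$$ where the inner sums are read as $1$ when $m=0$, and for $k=1$ the MRF $\mathbb{M}_v[\,]$ is $\mathbb{M}_v$.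
   Context: An MRF $\mathbb{M}=(\mathbb{G},\mathcal{X},\phi,f)$: finite simple graph $\mathbb{G}=(V,E)$, finite alphabet $\mathcal{X}$, $\phi_v:\mathcal{X}\to\mathbb{R}_+$, $f_{v,u}:\mathcal{X}\times\mathcal{X}\to\mathbb{R}_+$; $\mathbb{P}_{\mathbb{M}}(\mathbf{X}=\mathbf{x})=Z_{\mathbb{M}}^{ -1}\prod_v\phi_v(x_v)\prod_{(v,u)\in E}f_{v,u}(x_v,x_u)$. $\mathbb{M}_v$ is the MRF obtained by deleting node $v$ (keeping all other node and edge functions). For an MRF $\mathbb{M}'$ on graph $(V',E')$, nodes $u_1,\dots,u_r$ and $y_1,\dots,y_r\in\mathcal{X}$, $\mathbb{M}'[u_1,y_1;\dots;u_r,y_r]$ is the MRF on the subgraph induced by $V'\setminus\{u_1,\dots,u_r\}$ with the same alphabet and edge functions and node functions $\tilde\phi_w(x)=\phi_w(x)\prod_{i:(u_i,w)\in E'}f_{u_i,w}(y_i,x)$. -}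

module Defs where

open import Level using (Level; _⊔_) renaming (suc to lsuc)
open import Algebra.Bundles using (CommutativeRing)
open import Relation.Binary.Core using (Rel)
open import Relation.Binary.Structures using (IsStrictTotalOrder)
open import Relation.Nullary using (¬_; does)
open import Data.Bool using (Bool; true; false; _∧_; not; if_then_else_)
open import Data.Nat using (ℕ; _<ᵇ_)
open import Data.Fin using (Fin; toℕ; _≟_)
open import Data.List using (List; []; _∷_; _++_; [_]; map; concatMap; allFin; filterᵇ)
open import Data.Bool.ListAction using (any)
open import Data.Product using (_×_; _,_; proj₁)
open import Relation.Binary.PropositionalEquality using (_≡_)

-- Ordered fields (the reals ℝ are an instance).  The inverse is a total
-- function, only constrained on nonzero elements.

record OrderedField c ℓ₁ ℓ₂ : Set (lsuc (c ⊔ ℓ₁ ⊔ ℓ₂)) where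
  field
    commutativeRing : CommutativeRing c ℓ₁
  open CommutativeRing commutativeRing public
  field
    _<_                 : Rel Carrier ℓ₂
    <-isStrictTotalOrder : IsStrictTotalOrder _≈_ _<_
    0<1                 : 0# < 1#
    +-monoˡ-<           : ∀ z {x y} → x < y → (x + z) < (y + z)
    *-pos               : ∀ {x y} → 0# < x → 0# < y → 0# < (x * y)
    _⁻¹                 : Carrier → Carrier
    ⁻¹-cong             : ∀ {x y} → x ≈ y → (x ⁻¹) ≈ (y ⁻¹)
    ⁻¹-inverseʳ         : ∀ x → ¬ (x ≈ 0#) → (x * (x ⁻¹)) ≈ 1#

module MRFs {c ℓ₁ ℓ₂} (F : OrderedField c ℓ₁ ℓ₂) where
  open OrderedField F

  sumL : ∀ {a} {A : Set a} → List A → (A → Carrier) → Carrier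
  sumL []       g = 0#
  sumL (x ∷ xs) g = g x + sumL xs g

  prodL : ∀ {a} {A : Set a} → List A → (A → Carrier) → Carrier
  prodL []       g = 1#
  prodL (x ∷ xs) g = g x * prodL xs g

  -- An MRF with nodes a subset of Fin n and alphabet Fin q.
  -- The graph G = (V , E) has V = {i | nodes i ≡ true} and
  -- E = {{i , j} | i , j ∈ V , adj i j ≡ true}.
  record MRF (n q : ℕ) : Set c where
    field
      nodes : Fin n → Bool
      adj   : Fin n → Fin n → Bool
      φ     : Fin n → Fin q → Carrier
      f     : Fin n → Fin n → Fin q → Fin q → Carrier

  module _ {n q : ℕ} where

    isEdge : MRF n q → Fin n → Fin n → Bool
    isEdge M i j = MRF.nodes M i ∧ MRF.nodes M j ∧ MRF.adj M i j

    record IsSimple (M : MRF n q) : Set (c ⊔ ℓ₁) where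
      field
        adj-sym   : ∀ i j → MRF.adj M i j ≡ MRF.adj M j i
        adj-irrefl : ∀ i → MRF.adj M i i ≡ false
        f-sym     : ∀ i j x y → isEdge M i j ≡ true →
                    MRF.f M i j x y ≈ MRF.f M j i y x

    record IsPositive (M : MRF n q) : Set (c ⊔ ℓ₂) where
      field
        φ-pos : ∀ i x → MRF.nodes M i ≡ true → 0# < MRF.φ M i x
        f-pos : ∀ i j x y → isEdge M i j ≡ true → 0# < MRF.f M i j x y

    nodeList : MRF n q → List (Fin n)
    nodeList M = filterᵇ (MRF.nodes M) (allFin n)

    weight : MRF n q → (Fin n → Fin q) → Carrier
    weight M x =
      prodL (nodeList M) (λ i → MRF.φ M i (x i)) *
      prodL (nodeList M) (λ i →
        prodL (filterᵇ (λ j → (toℕ i <ᵇ toℕ j) ∧ isEdge M i j) (allFin n))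
              (λ j → MRF.f M i j (x i) (x j)))

    update : (Fin n → Fin q) → Fin n → Fin q → (Fin n → Fin q)
    update x i a j = if does (j ≟ i) then a else x j

    -- sum of g over all configurations that agree with the base
    -- configuration x outside the listed nodes
    sumCfg : List (Fin n) → (Fin n → Fin q) → ((Fin n → Fin q) → Carrier) → Carrier
    sumCfg []       x g = g x
    sumCfg (i ∷ is) x g = sumL (allFin q) (λ a → sumCfg is (update x i a) g)

    -- P_M(X_u = a).  Configurations range over the node set V of M; the
    -- values off V (here fixed to a) do not influence the weight.
    Prob : MRF n q → Fin n → Fin q → Carrier
    Prob M u a =
      sumCfg (nodeList M) (λ _ → a)
             (λ x → if does (x u ≟ a) then weight M x else 0#)
      * (sumCfg (nodeList M) (λ _ → a) (weight M) ⁻¹)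

    deleteNode : MRF n q → Fin n → MRF n q
    deleteNode M v = record M { nodes = λ i → MRF.nodes M i ∧ not (does (i ≟ v)) }

    memb : Fin n → List (Fin n × Fin q) → Bool
    memb w us = any (λ p → does (proj₁ p ≟ w)) us

    condition : MRF n q → List (Fin n × Fin q) → MRF n q
    condition M us = record M
      { nodes = λ w → MRF.nodes M w ∧ not (memb w us)
      ; φ     = λ w x → MRF.φ M w x *
                  prodL us (λ p → let (u , y) = p in
                    if isEdge M u w then MRF.f M u w y x else 1#)
      }

    assignments : List (Fin n) → List (List (Fin n × Fin q))
    assignments []       = [] ∷ []
    assignments (u ∷ us) =
      concatMap (λ a → map ((u , a) ∷_) (assignments us)) (allFin q)

    -- ∏_{k} f_{v,v_k}(x0,x_k) P_{M'[v_1,x_1;…;v_{k-1},x_{k-1}]}(X_{v_k}=x_k),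
    -- acc holds the already-conditioned prefix
    termProd : MRF n q → Fin n → Fin q → List (Fin n × Fin q) →
               List (Fin n × Fin q) → Carrier
    termProd M' v x0 acc []             = 1#
    termProd M' v x0 acc ((u , a) ∷ ps) =
      (MRF.f M' v u x0 a * Prob (condition M' acc) u a)
      * termProd M' v x0 (acc ++ [ (u , a) ]) ps

    innerSum : MRF n q → Fin n → List (Fin n) → Fin q → Carrier
    innerSum M v vs x0 =
      sumL (assignments vs) (λ ps → termProd (deleteNode M v) v x0 [] ps)

{-# OPTIONS --safe #-}
module Submission where

-- Fixing X_v = a splits the weight of M into φ_v(a) ∏_{w ∼ v} f_{v,w}(a, x_w) times the
-- weight of M_v.  So the numerator of P_M(X_v = x₀), and summed over a the partition
-- function Z_M, equal Z_{M_v} φ_v(a) E_{M_v}[∏_k f_{v,v_k}(a, X_{v_k})], and Z_{M_v} cancels.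
-- The expectation is expanded by the chain rule: fixing X_u = b in an MRF N gives
-- Z_N P_N(X_u = b) = φ_u(b) Z_{N[u,b]}, so conditioning on v_1, …, v_{k-1} in turn
-- produces the k-th factor of each term.

open import Defs
open import Level using (Level; _⊔_)
open import Algebra.Lattice.Properties.BooleanAlgebra using (deMorgan₂)
import Algebra.Properties.CommutativeSemigroup as CommutativeSemigroupProperties
open import Data.Bool using (Bool; true; false; _∧_; _∨_; not; if_then_else_; T; T?)
open import Data.Bool.Properties
  using (∧-assoc; ∧-zeroʳ; ∧-identityʳ; ∧-conicalˡ; ∧-conicalʳ; ∨-assoc; ∨-identityʳ; ¬-not; ∨-∧-booleanAlgebra)
open import Data.Bool.Solver using (module ∨-∧-Solver)
open import Data.Fin using (Fin; zero; suc; toℕ; _≟_)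
open import Data.Fin.Properties using (toℕ-injective)
open import Data.List using (List; []; _∷_; _++_; [_]; map; concatMap; filterᵇ; allFin; tabulate)
open import Data.List.Membership.Propositional using (_∈_; _∉_)
open import Data.List.Membership.Propositional.Properties using (∈-allFin; ∈-filter⁺; ∈-filter⁻)
open import Data.List.Properties using (filter-≐)
import Data.List.Relation.Unary.All as All
open import Data.List.Relation.Unary.All.Properties using (All¬⇒¬Any)
open import Data.List.Relation.Unary.AllPairs using ([]; _∷_)
open import Data.List.Relation.Unary.Any using (here; there)
open import Data.List.Relation.Unary.Any.Properties using (¬Any[])
open import Data.List.Relation.Unary.Unique.Propositional using (Unique)
open import Data.List.Relation.Unary.Unique.Propositional.Properties
  using (allFin⁺) renaming (filter⁺ to Unique-filter⁺)
open import Data.Nat using (ℕ; zero; suc; _<ᵇ_)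
open import Data.Product using (_×_; _,_; proj₁; proj₂)
open import Data.Unit using (⊤)
open import Function using (_∘_; const)
open import Function.Bundles using (_⇔_; mk⇔)
open Function.Bundles.Equivalence using (to; from)
open import Relation.Binary.PropositionalEquality as ≡ using (_≡_)
open import Relation.Binary.Structures using (IsStrictTotalOrder)
open import Relation.Nullary using (¬_; yes; no; does; contradiction)
open import Relation.Nullary.Decidable using (dec-true; dec-false; does-⇔)

private variable
  a b : Level
  A : Set a
  B : Set b

filterᵇ-cong : ∀ {p p' : A → Bool} → (∀ i → p i ≡ p' i) → ∀ xs → filterᵇ p xs ≡ filterᵇ p' xs
filterᵇ-cong {p = p} {p'} p≡p' =
  filter-≐ (T? ∘ p) (T? ∘ p') ((λ {i} → ≡.subst T (p≡p' i)) , (λ {i} → ≡.subst T (≡.sym (p≡p' i))))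

filterᵇ-filterᵇ : ∀ (p r : A → Bool) xs → filterᵇ r (filterᵇ p xs) ≡ filterᵇ (λ w → p w ∧ r w) xs
filterᵇ-filterᵇ p r []       = ≡.refl
filterᵇ-filterᵇ p r (x ∷ xs) with p x
... | false = filterᵇ-filterᵇ p r xs
... | true with r x
...   | true  = ≡.cong (x ∷_) (filterᵇ-filterᵇ p r xs)
...   | false = filterᵇ-filterᵇ p r xs

<ᵇ-flip : ∀ {m n} → ¬ m ≡ n → (n <ᵇ m) ≡ not (m <ᵇ n)
<ᵇ-flip {zero}  {zero}  m≢n = contradiction ≡.refl m≢n
<ᵇ-flip {zero}  {suc n} _   = ≡.refl
<ᵇ-flip {suc m} {zero}  _   = ≡.refl
<ᵇ-flip {suc m} {suc n} m≢n = <ᵇ-flip (m≢n ∘ ≡.cong suc)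

infixl 5 _∖_
_∖_ : ∀ {n} → List (Fin n) → Fin n → List (Fin n)
L ∖ u = filterᵇ (λ j → not (does (j ≟ u))) L

∉-∖ : ∀ {n} (L : List (Fin n)) u → u ∉ L ∖ u
∉-∖ L u u∈ = ≡.subst (T ∘ not) (dec-true (u ≟ u) ≡.refl) (proj₂ (∈-filter⁻ _ {xs = L} u∈))

∖-∉ : ∀ {n} {L : List (Fin n)} {u} → u ∉ L → L ∖ u ≡ L
∖-∉ {L = []}    u∉ = ≡.refl
∖-∉ {L = j ∷ L} {u} u∉ with j ≟ u
... | yes j≡u = contradiction (here (≡.sym j≡u)) u∉
... | no  _   = ≡.cong (j ∷_) (∖-∉ (u∉ ∘ there))

module Properties {c ℓ₁ ℓ₂} (𝔽 : OrderedField c ℓ₁ ℓ₂) where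
  open OrderedField 𝔽 hiding (zero)
  open MRFs 𝔽
  open import Relation.Binary.Reasoning.Setoid setoid
  open IsStrictTotalOrder <-isStrictTotalOrder using (irrefl; <-respʳ-≈) renaming (trans to <-trans)
  open CommutativeSemigroupProperties *-commutativeSemigroup
    using (x∙yz≈y∙xz; xy∙z≈xz∙y; xy∙z≈x∙zy) renaming (interchange to *-interchange)
  open CommutativeSemigroupProperties +-commutativeSemigroup
    using () renaming (interchange to +-interchange)

  -- x to the power [b] (Iverson bracket); `condition` builds its node functions in this form.
  infixl 25 _^[_]
  _^[_] : Carrier → Bool → Carrier
  x ^[ b ] = if b then x else 1#

  sumL-cong : ∀ (xs : List A) {g h : A → Carrier} → (∀ i → g i ≈ h i) → sumL xs g ≈ sumL xs h
  sumL-cong []       g≈h = refl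
  sumL-cong (x ∷ xs) g≈h = +-cong (g≈h x) (sumL-cong xs g≈h)

  prodL-cong : ∀ (xs : List A) {g h : A → Carrier} → (∀ i → g i ≈ h i) → prodL xs g ≈ prodL xs h
  prodL-cong []       g≈h = refl
  prodL-cong (x ∷ xs) g≈h = *-cong (g≈h x) (prodL-cong xs g≈h)

  sumL-zero : ∀ (xs : List A) {g : A → Carrier} → (∀ i → g i ≈ 0#) → sumL xs g ≈ 0#
  sumL-zero []       g≈0 = refl
  sumL-zero (x ∷ xs) g≈0 = trans (+-cong (g≈0 x) (sumL-zero xs g≈0)) (+-identityˡ 0#)

  prodL-one : ∀ (xs : List A) {g : A → Carrier} → (∀ i → g i ≈ 1#) → prodL xs g ≈ 1#
  prodL-one []       g≈1 = refl
  prodL-one (x ∷ xs) g≈1 = trans (*-cong (g≈1 x) (prodL-one xs g≈1)) (*-identityˡ 1#)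

  sumL-+ : ∀ (xs : List A) (g h : A → Carrier) →
           sumL xs (λ i → g i + h i) ≈ sumL xs g + sumL xs h
  sumL-+ []       g h = sym (+-identityˡ 0#)
  sumL-+ (x ∷ xs) g h = trans (+-congˡ (sumL-+ xs g h)) (+-interchange _ _ _ _)

  prodL-* : ∀ (xs : List A) (g h : A → Carrier) →
            prodL xs (λ i → g i * h i) ≈ prodL xs g * prodL xs h
  prodL-* []       g h = sym (*-identityˡ 1#)
  prodL-* (x ∷ xs) g h = trans (*-congˡ (prodL-* xs g h)) (*-interchange _ _ _ _)

  sumL-*ˡ : ∀ (xs : List A) k (g : A → Carrier) → sumL xs (λ i → k * g i) ≈ k * sumL xs g
  sumL-*ˡ []       k g = sym (zeroʳ k)
  sumL-*ˡ (x ∷ xs) k g = trans (+-congˡ (sumL-*ˡ xs k g)) (sym (distribˡ k _ _))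

  sumL-++ : ∀ (xs ys : List A) (g : A → Carrier) → sumL (xs ++ ys) g ≈ sumL xs g + sumL ys g
  sumL-++ []       ys g = sym (+-identityˡ _)
  sumL-++ (x ∷ xs) ys g = trans (+-congˡ (sumL-++ xs ys g)) (sym (+-assoc _ _ _))

  prodL-++ : ∀ (xs ys : List A) (g : A → Carrier) → prodL (xs ++ ys) g ≈ prodL xs g * prodL ys g
  prodL-++ []       ys g = sym (*-identityˡ _)
  prodL-++ (x ∷ xs) ys g = trans (*-congˡ (prodL-++ xs ys g)) (sym (*-assoc _ _ _))

  sumL-map : ∀ (m : B → A) (xs : List B) (g : A → Carrier) →
             sumL (map m xs) g ≈ sumL xs (λ b → g (m b))
  sumL-map m []       g = refl
  sumL-map m (x ∷ xs) g = +-congˡ (sumL-map m xs g)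

  sumL-concatMap : ∀ (k : B → List A) (xs : List B) (g : A → Carrier) →
                   sumL (concatMap k xs) g ≈ sumL xs (λ b → sumL (k b) g)
  sumL-concatMap k []       g = refl
  sumL-concatMap k (x ∷ xs) g = trans (sumL-++ (k x) _ g) (+-congˡ (sumL-concatMap k xs g))

  sumL-comm : ∀ (xs : List A) (ys : List B) (g : A → B → Carrier) →
              sumL xs (λ a → sumL ys (g a)) ≈ sumL ys (λ b → sumL xs (λ a → g a b))
  sumL-comm []       ys g = sym (sumL-zero ys (λ _ → refl))
  sumL-comm (x ∷ xs) ys g = trans (+-congˡ (sumL-comm xs ys g)) (sym (sumL-+ ys _ _))

  prodL-filterᵇ : ∀ (p : A → Bool) (xs : List A) (g : A → Carrier) →
                  prodL (filterᵇ p xs) g ≈ prodL xs (λ i → g i ^[ p i ])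
  prodL-filterᵇ p []       g = refl
  prodL-filterᵇ p (x ∷ xs) g with p x
  ... | true  = *-congˡ (prodL-filterᵇ p xs g)
  ... | false = trans (prodL-filterᵇ p xs g) (sym (*-identityˡ _))

  ^[]-true : ∀ {b x} → b ≡ true → x ^[ b ] ≈ x
  ^[]-true ≡.refl = refl

  ^[]-false : ∀ {b x} → b ≡ false → x ^[ b ] ≈ 1#
  ^[]-false ≡.refl = refl

  ^[]-cong : ∀ {b b' x y} → b ≡ b' → (b ≡ true → x ≈ y) → x ^[ b ] ≈ y ^[ b' ]
  ^[]-cong {true}  ≡.refl x≈y = x≈y ≡.refl
  ^[]-cong {false} ≡.refl _   = refl

  ^[]-one : ∀ b {x} → x ≈ 1# → x ^[ b ] ≈ 1#
  ^[]-one true  x≈1 = x≈1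
  ^[]-one false _   = refl

  ^[]-* : ∀ b x y → (x * y) ^[ b ] ≈ x ^[ b ] * y ^[ b ]
  ^[]-* true  x y = refl
  ^[]-* false x y = sym (*-identityˡ 1#)

  ^[]-split : ∀ d {b} x → x ^[ b ] ≈ x ^[ d ∧ b ] * x ^[ b ∧ not d ]
  ^[]-split true  {b} x = sym (trans (*-congˡ (^[]-false (∧-zeroʳ b))) (*-identityʳ _))
  ^[]-split false {b} x = sym (trans (*-identityˡ _) (^[]-cong (∧-identityʳ b) (λ _ → refl)))

  ^[]-∧ : ∀ d {b} x → x ^[ d ∧ b ] ≈ x ^[ b ] ^[ d ]
  ^[]-∧ true  x = refl
  ^[]-∧ false x = refl

  ^[]-not : ∀ b x → x ^[ b ] * x ^[ not b ] ≈ x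
  ^[]-not true  x = *-identityʳ x
  ^[]-not false x = *-identityˡ x

  prodL-^[] : ∀ (xs : List A) d (g : A → Carrier) → prodL xs (λ i → g i ^[ d ]) ≈ prodL xs g ^[ d ]
  prodL-^[] xs true  g = refl
  prodL-^[] xs false g = prodL-one xs (λ _ → refl)

  ^[]-pos : ∀ b {x} → (b ≡ true → 0# < x) → 0# < x ^[ b ]
  ^[]-pos true  0<x = 0<x ≡.refl
  ^[]-pos false _   = 0<1

  module _ {k : ℕ} where

    sumL-indicator-∉ : ∀ (xs : List (Fin k)) {u} (g : Fin k → Carrier) → u ∉ xs →
                       sumL xs (λ a → if does (a ≟ u) then g a else 0#) ≈ 0#
    sumL-indicator-∉ []       g u∉ = refl
    sumL-indicator-∉ (x ∷ xs) {u} g u∉ with x ≟ u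
    ... | yes x≡u = contradiction (here (≡.sym x≡u)) u∉
    ... | no  _   = trans (+-congˡ (sumL-indicator-∉ xs g (u∉ ∘ there))) (+-identityˡ 0#)

    sumL-indicator : ∀ {xs : List (Fin k)} {u} (g : Fin k → Carrier) → Unique xs → u ∈ xs →
                     sumL xs (λ a → if does (a ≟ u) then g a else 0#) ≈ g u
    sumL-indicator {x ∷ xs} {u} g (x∉ ∷ !xs) u∈ with x ≟ u
    ... | yes ≡.refl = trans (+-congˡ (sumL-indicator-∉ xs g (All¬⇒¬Any x∉))) (+-identityʳ _)
    sumL-indicator g (x∉ ∷ !xs) (here u≡x)  | no x≢u = contradiction (≡.sym u≡x) x≢u
    sumL-indicator g (x∉ ∷ !xs) (there u∈) | no _   =
      trans (+-congˡ (sumL-indicator g !xs u∈)) (+-identityˡ _)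

    prodL-indicator-∉ : ∀ (xs : List (Fin k)) {u} (g : Fin k → Carrier) → u ∉ xs →
                        prodL xs (λ a → g a ^[ does (a ≟ u) ]) ≈ 1#
    prodL-indicator-∉ []       g u∉ = refl
    prodL-indicator-∉ (x ∷ xs) {u} g u∉ with x ≟ u
    ... | yes x≡u = contradiction (here (≡.sym x≡u)) u∉
    ... | no  _   = trans (*-congˡ (prodL-indicator-∉ xs g (u∉ ∘ there))) (*-identityˡ 1#)

    prodL-indicator : ∀ {xs : List (Fin k)} {u} (g : Fin k → Carrier) → Unique xs → u ∈ xs →
                      prodL xs (λ a → g a ^[ does (a ≟ u) ]) ≈ g u
    prodL-indicator {x ∷ xs} {u} g (x∉ ∷ !xs) u∈ with x ≟ u
    ... | yes ≡.refl = trans (*-congˡ (prodL-indicator-∉ xs g (All¬⇒¬Any x∉))) (*-identityʳ _)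
    prodL-indicator g (x∉ ∷ !xs) (here u≡x)  | no x≢u = contradiction (≡.sym u≡x) x≢u
    prodL-indicator g (x∉ ∷ !xs) (there u∈) | no _   =
      trans (*-congˡ (prodL-indicator g !xs u∈)) (*-identityˡ _)

    sumL-allFin-indicator : ∀ u (g : Fin k → Carrier) →
                            sumL (allFin k) (λ a → if does (a ≟ u) then g a else 0#) ≈ g u
    sumL-allFin-indicator u g = sumL-indicator g (allFin⁺ k) (∈-allFin u)

    prodL-allFin-indicator : ∀ u (g : Fin k → Carrier) →
                             prodL (allFin k) (λ a → g a ^[ does (a ≟ u) ]) ≈ g u
    prodL-allFin-indicator u g = prodL-indicator g (allFin⁺ k) (∈-allFin u)

    prodL-enumerates : ∀ {vs : List (Fin k)} (p : Fin k → Bool) (g : Fin k → Carrier) → Unique vs →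
      (∀ u → u ∈ vs ⇔ (p u ≡ true)) → prodL vs g ≈ prodL (allFin k) (λ j → g j ^[ p j ])
    prodL-enumerates {[]} p g _ enum =
      sym (prodL-one (allFin k) (λ j → ^[]-false (¬-not (¬Any[] ∘ from (enum j)))))
    prodL-enumerates {w ∷ ws} p g (w∉ws ∷ unique) enum = sym (begin
      prodL (allFin k) (λ j → g j ^[ p j ])
        ≈⟨ prodL-cong (allFin k) (λ j → ^[]-split (does (j ≟ w)) (g j)) ⟩
      prodL (allFin k) (λ j → g j ^[ does (j ≟ w) ∧ p j ] * g j ^[ p' j ])
        ≈⟨ prodL-* (allFin k) _ _ ⟩
      prodL (allFin k) (λ j → g j ^[ does (j ≟ w) ∧ p j ]) * prodL (allFin k) (λ j → g j ^[ p' j ])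
        ≈⟨ *-cong (trans (prodL-cong (allFin k) (λ j → ^[]-∧ (does (j ≟ w)) (g j)))
                         (trans (prodL-allFin-indicator w (λ j → g j ^[ p j ]))
                                (^[]-true (to (enum w) (here ≡.refl)))))
                  (sym (prodL-enumerates p' g unique (λ u → mk⇔ (to' u) from'))) ⟩
      g w * prodL ws g ∎)
      where
      p' : Fin k → Bool
      p' j = p j ∧ not (does (j ≟ w))
      to' : ∀ u → u ∈ ws → p' u ≡ true
      to' u u∈ws = ≡.cong₂ (λ b d → b ∧ not d) (to (enum u) (there u∈ws))
                                               (dec-false (u ≟ w) (All.lookup w∉ws u∈ws ∘ ≡.sym))
      p'w≡false : p' w ≡ false
      p'w≡false = ≡.trans (≡.cong (λ d → p w ∧ not d) (dec-true (w ≟ w) ≡.refl)) (∧-zeroʳ (p w))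
      from' : ∀ {u} → p' u ≡ true → u ∈ ws
      from' {u} p'u with from (enum u) (∧-conicalˡ _ _ p'u)
      ... | here ≡.refl = contradiction (≡.trans (≡.sym p'u) p'w≡false) λ ()
      ... | there u∈ws  = u∈ws

  +-pos : ∀ {x y} → 0# < x → 0# < y → 0# < (x + y)
  +-pos {x} {y} 0<x 0<y = <-trans (<-respʳ-≈ (sym (+-identityˡ y)) 0<y) (+-monoˡ-< y 0<x)

  prodL-pos : ∀ (xs : List A) {g : A → Carrier} → (∀ i → 0# < g i) → 0# < prodL xs g
  prodL-pos []       g>0 = 0<1
  prodL-pos (x ∷ xs) g>0 = *-pos (g>0 x) (prodL-pos xs g>0)

  sumL-pos : ∀ x (xs : List A) {g : A → Carrier} → (∀ i → 0# < g i) → 0# < sumL (x ∷ xs) g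
  sumL-pos x []       g>0 = <-respʳ-≈ (sym (+-identityʳ _)) (g>0 x)
  sumL-pos x (y ∷ xs) g>0 = +-pos (g>0 x) (sumL-pos y xs g>0)

  sumL-allFin-pos : ∀ {k} → Fin k → {g : Fin k → Carrier} → (∀ i → 0# < g i) → 0# < sumL (allFin k) g
  sumL-allFin-pos zero    = sumL-pos zero (tabulate suc)
  sumL-allFin-pos (suc _) = sumL-pos zero (tabulate suc)

  pos⇒≉0 : ∀ {x} → 0# < x → x ≉ 0#
  pos⇒≉0 0<x x≈0 = irrefl (sym x≈0) 0<x

  *-cancel-⁻¹ : ∀ {x y} → x ≉ 0# → x * (y * x ⁻¹) ≈ y
  *-cancel-⁻¹ {x} {y} x≉0 = begin
    x * (y * x ⁻¹) ≈⟨ x∙yz≈y∙xz x y _ ⟩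
    y * (x * x ⁻¹) ≈⟨ *-congˡ (⁻¹-inverseʳ x x≉0) ⟩
    y * 1#         ≈⟨ *-identityʳ y ⟩
    y              ∎

  ⁻¹-unique : ∀ {x y} → x ≉ 0# → x * y ≈ 1# → y ≈ x ⁻¹
  ⁻¹-unique {x} {y} x≉0 xy≈1 = begin
    y                  ≈⟨ sym (*-cancel-⁻¹ x≉0) ⟩
    x * (y * x ⁻¹)     ≈⟨ sym (*-assoc x y _) ⟩
    (x * y) * x ⁻¹     ≈⟨ *-congʳ xy≈1 ⟩
    1# * x ⁻¹          ≈⟨ *-identityˡ _ ⟩
    x ⁻¹               ∎

  *-cancelˡ-/ : ∀ {c x y} → c * y ≉ 0# → (c * x) * (c * y) ⁻¹ ≈ x * y ⁻¹
  *-cancelˡ-/ {c} {x} {y} cy≉0 = begin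
    (c * x) * (c * y) ⁻¹ ≈⟨ *-congʳ (*-comm c x) ⟩
    (x * c) * (c * y) ⁻¹ ≈⟨ *-assoc x c _ ⟩
    x * (c * (c * y) ⁻¹) ≈⟨ *-congˡ (⁻¹-unique y≉0 y[c/cy]≈1) ⟩
    x * y ⁻¹             ∎
    where
    y≉0 : y ≉ 0#
    y≉0 y≈0 = cy≉0 (trans (*-congˡ y≈0) (zeroʳ c))
    y[c/cy]≈1 : y * (c * (c * y) ⁻¹) ≈ 1#
    y[c/cy]≈1 = trans (sym (*-assoc y c _)) (trans (*-congʳ (*-comm y c)) (⁻¹-inverseʳ _ cy≉0))

  module _ {n q : ℕ} where

    Cfg : Set
    Cfg = Fin n → Fin q

    update-same : ∀ (x : Cfg) i a → update x i a i ≡ a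
    update-same x i a with i ≟ i
    ... | yes _   = ≡.refl
    ... | no  i≢i = contradiction ≡.refl i≢i

    update-other : ∀ (x : Cfg) i a {j} → ¬ j ≡ i → update x i a j ≡ x j
    update-other x i a {j} j≢i with j ≟ i
    ... | yes j≡i = contradiction j≡i j≢i
    ... | no  _   = ≡.refl

    update-comm : ∀ (x : Cfg) {i u} b a → ¬ i ≡ u → ∀ j →
                  update (update x i b) u a j ≡ update (update x u a) i b j
    update-comm x {i} {u} b a i≢u j with j ≟ u | j ≟ i
    ... | yes ≡.refl | yes ≡.refl = contradiction ≡.refl i≢u
    ... | yes _      | no  _      = ≡.refl
    ... | no  _      | yes _      = ≡.refl
    ... | no  _      | no  _      = ≡.refl

    -- Configurations are functions and there is no function extensionality, so sums over
    -- them are rewritten only along integrands that respect pointwise equality (on P).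
    Local : (Fin n → Set) → (Cfg → Carrier) → Set ℓ₁
    Local P g = ∀ z w → (∀ j → P j → z j ≡ w j) → g z ≈ g w

    Extensional : (Cfg → Carrier) → Set ℓ₁
    Extensional = Local (λ _ → ⊤)

    sumCfg-cong : ∀ (L : List (Fin n)) y {g h : Cfg → Carrier} →
                  (∀ z → (∀ j → j ∉ L → z j ≡ y j) → g z ≈ h z) →
                  sumCfg L y g ≈ sumCfg L y h
    sumCfg-cong []       y g≈h = g≈h y (λ _ _ → ≡.refl)
    sumCfg-cong (i ∷ is) y g≈h = sumL-cong (allFin q) λ a →
      sumCfg-cong is (update y i a) λ z z≡ → g≈h z λ j j∉ →
        ≡.trans (z≡ j (j∉ ∘ there)) (update-other y i a (j∉ ∘ here))

    sumCfg-rebase : ∀ (L : List (Fin n)) {P} {g : Cfg → Carrier} → Local P g → ∀ {y y'} →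
                    (∀ j → P j → j ∉ L → y j ≡ y' j) →
                    sumCfg L y g ≈ sumCfg L y' g
    sumCfg-rebase []       g-local y≡y' = g-local _ _ (λ j Pj → y≡y' j Pj λ ())
    sumCfg-rebase (i ∷ is) g-local {y} {y'} y≡y' = sumL-cong (allFin q) λ a →
      sumCfg-rebase is g-local (updates≡ a)
      where
      updates≡ : ∀ a j → _ → j ∉ is → update y i a j ≡ update y' i a j
      updates≡ a j Pj j∉ with j ≟ i
      ... | yes _   = ≡.refl
      ... | no  j≢i = y≡y' j Pj λ { (here j≡i) → j≢i j≡i ; (there j∈) → j∉ j∈ }

    sumCfg-*ˡ : ∀ (L : List (Fin n)) y k (g : Cfg → Carrier) →
                sumCfg L y (λ x → k * g x) ≈ k * sumCfg L y g
    sumCfg-*ˡ []       y k g = refl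
    sumCfg-*ˡ (i ∷ is) y k g =
      trans (sumL-cong (allFin q) (λ a → sumCfg-*ˡ is (update y i a) k g)) (sumL-*ˡ (allFin q) k _)

    sumCfg-zero : ∀ (L : List (Fin n)) y → sumCfg L y (λ _ → 0#) ≈ 0#
    sumCfg-zero []       y = refl
    sumCfg-zero (i ∷ is) y = sumL-zero (allFin q) (λ a → sumCfg-zero is (update y i a))

    sumCfg-pos : ∀ (L : List (Fin n)) y {g : Cfg → Carrier} → Fin q →
                 (∀ z → 0# < g z) → 0# < sumCfg L y g
    sumCfg-pos []       y a g>0 = g>0 y
    sumCfg-pos (i ∷ is) y a g>0 = sumL-allFin-pos a (λ b → sumCfg-pos is (update y i b) b g>0)

    sumCfg-pick : ∀ {L : List (Fin n)} {u} y {g : Cfg → Carrier} → Unique L → u ∈ L → Extensional g →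
                  sumCfg L y g ≈ sumL (allFin q) (λ a → sumCfg (L ∖ u) (update y u a) g)
    sumCfg-pick {i ∷ is} {u} y (i∉ ∷ !is) u∈ g-ext with i ≟ u
    ... | yes ≡.refl = reflexive (≡.cong (λ L → sumL (allFin q) (λ a → sumCfg L (update y i a) _))
                                         (≡.sym (∖-∉ (All¬⇒¬Any i∉))))
    sumCfg-pick y (i∉ ∷ !is) (here u≡i) g-ext | no i≢u = contradiction (≡.sym u≡i) i≢u
    sumCfg-pick {i ∷ is} {u} y {g} (i∉ ∷ !is) (there u∈) g-ext | no i≢u = begin
      sumL (allFin q) (λ b → sumCfg is (update y i b) g)
        ≈⟨ sumL-cong (allFin q) (λ b → sumCfg-pick (update y i b) !is u∈ g-ext) ⟩
      sumL (allFin q) (λ b → sumL (allFin q) (λ a → sumCfg (is ∖ u) (update (update y i b) u a) g))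
        ≈⟨ sumL-comm (allFin q) (allFin q) _ ⟩
      sumL (allFin q) (λ a → sumL (allFin q) (λ b → sumCfg (is ∖ u) (update (update y i b) u a) g))
        ≈⟨ sumL-cong (allFin q) (λ a → sumL-cong (allFin q) (λ b →
             sumCfg-rebase (is ∖ u) g-ext (λ j _ _ → update-comm y b a i≢u j))) ⟩
      sumL (allFin q) (λ a → sumL (allFin q) (λ b → sumCfg (is ∖ u) (update (update y u a) i b) g)) ∎

    sumCfg-indicator : ∀ {L : List (Fin n)} {u} a y {g : Cfg → Carrier} →
                       Unique L → u ∈ L → Extensional g →
                       sumCfg L y (λ x → if does (x u ≟ a) then g x else 0#)
                         ≈ sumCfg (L ∖ u) (update y u a) g
    sumCfg-indicator {L} {u} a y {g} !L u∈ g-ext = begin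
      sumCfg L y gₐ
        ≈⟨ sumCfg-pick y !L u∈ gₐ-ext ⟩
      sumL (allFin q) (λ b → sumCfg (L ∖ u) (update y u b) gₐ)
        ≈⟨ sumL-cong (allFin q) fixed ⟩
      sumL (allFin q) (λ b → if does (b ≟ a) then sumCfg (L ∖ u) (update y u b) g else 0#)
        ≈⟨ sumL-allFin-indicator a _ ⟩
      sumCfg (L ∖ u) (update y u a) g ∎
      where
      gₐ : Cfg → Carrier
      gₐ x = if does (x u ≟ a) then g x else 0#
      gₐ-ext : Extensional gₐ
      gₐ-ext z w z≡w with z u ≟ a | w u ≟ a
      ... | yes _    | yes _    = g-ext z w z≡w
      ... | no  _    | no  _    = refl
      ... | yes zu≡a | no  wu≢a = contradiction (≡.trans (≡.sym (z≡w u _)) zu≡a) wu≢a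
      ... | no  zu≢a | yes wu≡a = contradiction (≡.trans (z≡w u _) wu≡a) zu≢a
      x≡b : ∀ b x → (∀ j → j ∉ L ∖ u → x j ≡ update y u b j) → x u ≡ b
      x≡b b x x≡ = ≡.trans (x≡ u (∉-∖ L u)) (update-same y u b)
      fixed : ∀ b → sumCfg (L ∖ u) (update y u b) gₐ
                    ≈ (if does (b ≟ a) then sumCfg (L ∖ u) (update y u b) g else 0#)
      fixed b with b ≟ a
      ... | yes ≡.refl = sumCfg-cong (L ∖ u) _ λ x x≡ → gₐ≈g x (x≡b b x x≡)
        where
        gₐ≈g : ∀ x → x u ≡ b → gₐ x ≈ g x
        gₐ≈g x xu≡b with x u ≟ b
        ... | yes _    = refl
        ... | no  xu≢b = contradiction xu≡b xu≢b
      ... | no b≢a = trans (sumCfg-cong (L ∖ u) _ λ x x≡ → gₐ≈0 x (x≡b b x x≡)) (sumCfg-zero (L ∖ u) _)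
        where
        gₐ≈0 : ∀ x → x u ≡ b → gₐ x ≈ 0#
        gₐ≈0 x xu≡b with x u ≟ a
        ... | yes xu≡a = contradiction (≡.trans (≡.sym xu≡b) xu≡a) b≢a
        ... | no  _    = refl

    isEdge⇒nodesˡ : ∀ (N : MRF n q) {i j} → isEdge N i j ≡ true → MRF.nodes N i ≡ true
    isEdge⇒nodesˡ N e = ∧-conicalˡ _ _ e

    isEdge⇒nodesʳ : ∀ (N : MRF n q) {i j} → isEdge N i j ≡ true → MRF.nodes N j ≡ true
    isEdge⇒nodesʳ N {i} e = ∧-conicalˡ _ _ (∧-conicalʳ (MRF.nodes N i) _ e)

    isEdge-sym : ∀ {N : MRF n q} → IsSimple N → ∀ i j → isEdge N i j ≡ isEdge N j i
    isEdge-sym {N} simple i j = ≡.trans (≡.cong (λ b → MRF.nodes N i ∧ (MRF.nodes N j ∧ b)) (adj-sym i j))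
                                       (∧-leftComm (MRF.nodes N i) (MRF.nodes N j) (MRF.adj N j i))
      where
      open IsSimple simple
      open ∨-∧-Solver
      ∧-leftComm : ∀ a b c → a ∧ (b ∧ c) ≡ b ∧ (a ∧ c)
      ∧-leftComm = solve 3 (λ a b c → a :* (b :* c) := b :* (a :* c)) ≡.refl

    isEdge-irrefl : ∀ {N : MRF n q} → IsSimple N → ∀ i → isEdge N i i ≡ false
    isEdge-irrefl {N} simple i = ≡.trans (≡.cong (λ b → MRF.nodes N i ∧ (MRF.nodes N i ∧ b)) (adj-irrefl i))
                                        (≡.trans (≡.cong (MRF.nodes N i ∧_) (∧-zeroʳ _)) (∧-zeroʳ _))
      where open IsSimple simple

    isEdge-on-nodes : ∀ (N : MRF n q) {i j} → MRF.nodes N i ≡ true → MRF.nodes N j ≡ true →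
                      isEdge N i j ≡ MRF.adj N i j
    isEdge-on-nodes N i∈ j∈ = ≡.cong₂ (λ a b → a ∧ (b ∧ _)) i∈ j∈

    isEdge-deleteNode : ∀ (N : MRF n q) u i j →
      isEdge (deleteNode N u) i j ≡ (isEdge N i j ∧ not (does (i ≟ u))) ∧ not (does (j ≟ u))
    isEdge-deleteNode N u i j = ∧-rearrange (MRF.nodes N i) _ (MRF.nodes N j) _ (MRF.adj N i j)
      where
      open ∨-∧-Solver
      ∧-rearrange : ∀ a p b r c → (a ∧ p) ∧ ((b ∧ r) ∧ c) ≡ ((a ∧ (b ∧ c)) ∧ p) ∧ r
      ∧-rearrange = solve 5 (λ a p b r c → (a :* p) :* ((b :* r) :* c) := ((a :* (b :* c)) :* p) :* r) ≡.refl

    isEdge-mono : ∀ (N' N : MRF n q) → (∀ i → MRF.nodes N' i ≡ true → MRF.nodes N i ≡ true) →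
                  (∀ i j → MRF.adj N' i j ≡ MRF.adj N i j) →
                  ∀ {i j} → isEdge N' i j ≡ true → isEdge N i j ≡ true
    isEdge-mono N' N nodes⊆ adj≡ {i} {j} e = ≡.cong₂ _∧_ (nodes⊆ i (isEdge⇒nodesˡ N' e))
      (≡.cong₂ _∧_ (nodes⊆ j (isEdge⇒nodesʳ N' e))
                   (≡.trans (≡.sym (adj≡ i j)) (∧-conicalʳ _ _ (∧-conicalʳ (MRF.nodes N' i) _ e))))

    isEdge-deleteNode⇒ : ∀ (N : MRF n q) u {i j} → isEdge (deleteNode N u) i j ≡ true → isEdge N i j ≡ true
    isEdge-deleteNode⇒ N u = isEdge-mono (deleteNode N u) N (λ i → ∧-conicalˡ _ _) (λ _ _ → ≡.refl)

    isEdge-condition⇒ : ∀ (N : MRF n q) acc {i j} → isEdge (condition N acc) i j ≡ true → isEdge N i j ≡ true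
    isEdge-condition⇒ N acc = isEdge-mono (condition N acc) N (λ i → ∧-conicalˡ _ _) (λ _ _ → ≡.refl)

    -- `weight` with its filtered lists replaced by Iverson exponents over all of Fin n
    -- (weight-factorises): in this form deleting or conditioning a node is a pointwise computation.
    nodeFactor : MRF n q → Cfg → Carrier
    nodeFactor N x = prodL (allFin n) (λ i → MRF.φ N i (x i) ^[ MRF.nodes N i ])

    edgeFactor : MRF n q → Cfg → Carrier
    edgeFactor N x = prodL (allFin n) λ i → prodL (allFin n) λ j →
      MRF.f N i j (x i) (x j) ^[ (toℕ i <ᵇ toℕ j) ∧ isEdge N i j ]

    weight-factorises : ∀ (N : MRF n q) x → weight N x ≈ nodeFactor N x * edgeFactor N x
    weight-factorises N x =
      *-cong (prodL-filterᵇ (MRF.nodes N) (allFin n) _)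
             (trans (prodL-filterᵇ (MRF.nodes N) (allFin n) _) (prodL-cong (allFin n) row))
      where
      row : ∀ i → prodL (filterᵇ (λ j → (toℕ i <ᵇ toℕ j) ∧ isEdge N i j) (allFin n))
                        (λ j → MRF.f N i j (x i) (x j)) ^[ MRF.nodes N i ]
                  ≈ prodL (allFin n) (λ j → MRF.f N i j (x i) (x j) ^[ (toℕ i <ᵇ toℕ j) ∧ isEdge N i j ])
      row i with MRF.nodes N i
      ... | true  = prodL-filterᵇ _ (allFin n) _
      ... | false = sym (prodL-one (allFin n) λ j → ^[]-false (∧-zeroʳ (toℕ i <ᵇ toℕ j)))

    nodeFactor-cong : ∀ (N N' : MRF n q) {x x'} → (∀ i → MRF.nodes N i ≡ MRF.nodes N' i) →
                      (∀ i → MRF.nodes N i ≡ true → MRF.φ N i (x i) ≈ MRF.φ N' i (x' i)) →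
                      nodeFactor N x ≈ nodeFactor N' x'
    nodeFactor-cong _ _ nodes≡ φ≈ = prodL-cong (allFin n) (λ i → ^[]-cong (nodes≡ i) (φ≈ i))

    edgeFactor-cong : ∀ (N N' : MRF n q) {x x'} → (∀ i → MRF.nodes N i ≡ MRF.nodes N' i) →
                      (∀ i j → MRF.adj N i j ≡ MRF.adj N' i j) →
                      (∀ i j → isEdge N i j ≡ true → MRF.f N i j (x i) (x j) ≈ MRF.f N' i j (x' i) (x' j)) →
                      edgeFactor N x ≈ edgeFactor N' x'
    edgeFactor-cong _ _ nodes≡ adj≡ f≈ = prodL-cong (allFin n) λ i → prodL-cong (allFin n) λ j →
      ^[]-cong (≡.cong₂ (λ a b → (toℕ i <ᵇ toℕ j) ∧ (a ∧ b)) (nodes≡ i) (≡.cong₂ _∧_ (nodes≡ j) (adj≡ i j)))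
               (λ e → f≈ i j (∧-conicalʳ (toℕ i <ᵇ toℕ j) _ e))

    weight-cong : ∀ (N N' : MRF n q) {x x'} → (∀ i → MRF.nodes N i ≡ MRF.nodes N' i) →
                  (∀ i j → MRF.adj N i j ≡ MRF.adj N' i j) →
                  (∀ i → MRF.nodes N i ≡ true → MRF.φ N i (x i) ≈ MRF.φ N' i (x' i)) →
                  (∀ i j → isEdge N i j ≡ true → MRF.f N i j (x i) (x j) ≈ MRF.f N' i j (x' i) (x' j)) →
                  weight N x ≈ weight N' x'
    weight-cong N N' {x} {x'} nodes≡ adj≡ φ≈ f≈ = begin
      weight N x                          ≈⟨ weight-factorises N x ⟩
      nodeFactor N x * edgeFactor N x     ≈⟨ *-cong (nodeFactor-cong N N' nodes≡ φ≈)
                                                   (edgeFactor-cong N N' nodes≡ adj≡ f≈) ⟩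
      nodeFactor N' x' * edgeFactor N' x' ≈⟨ weight-factorises N' x' ⟨
      weight N' x'                        ∎

    weight-local : ∀ (N : MRF n q) → Local (λ j → MRF.nodes N j ≡ true) (weight N)
    weight-local N z w z≡w = weight-cong N N (λ _ → ≡.refl) (λ _ _ → ≡.refl)
      (λ i i∈N → reflexive (≡.cong (MRF.φ N i) (z≡w i i∈N)))
      (λ i j e → reflexive (≡.cong₂ (MRF.f N i j) (z≡w i (isEdge⇒nodesˡ N e)) (z≡w j (isEdge⇒nodesʳ N e))))

    weight-ext : ∀ (N : MRF n q) → Extensional (weight N)
    weight-ext N z w z≡w = weight-local N z w (λ j _ → z≡w j _)

    weight-pos : ∀ {N : MRF n q} → IsPositive N → ∀ x → 0# < weight N x
    weight-pos {N} positive x = <-respʳ-≈ (sym (weight-factorises N x)) (*-pos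
      (prodL-pos (allFin n) λ i → ^[]-pos (MRF.nodes N i) (φ-pos i _))
      (prodL-pos (allFin n) λ i → prodL-pos (allFin n) λ j →
         ^[]-pos ((toℕ i <ᵇ toℕ j) ∧ isEdge N i j) (λ e → f-pos i j _ _ (∧-conicalʳ (toℕ i <ᵇ toℕ j) _ e))))
      where open IsPositive positive

    module _ {N : MRF n q} (simple : IsSimple N) {u} (u∈N : MRF.nodes N u ≡ true) (x : Cfg) where
      private
        F : Fin n → Fin n → Carrier
        F i j = MRF.f N i j (x i) (x j)
        lt : Fin n → Fin n → Bool
        lt i j = toℕ i <ᵇ toℕ j
        d : Fin n → Bool
        d i = does (i ≟ u)

      nodeFactor-deleteNode : nodeFactor N x ≈ MRF.φ N u (x u) * nodeFactor (deleteNode N u) x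
      nodeFactor-deleteNode = begin
        nodeFactor N x
          ≈⟨ prodL-cong (allFin n) (λ i → ^[]-split (d i) (Φ i)) ⟩
        prodL (allFin n) (λ i → Φ i ^[ d i ∧ MRF.nodes N i ] * Φ i ^[ MRF.nodes N i ∧ not (d i) ])
          ≈⟨ prodL-* (allFin n) _ _ ⟩
        prodL (allFin n) (λ i → Φ i ^[ d i ∧ MRF.nodes N i ]) * nodeFactor (deleteNode N u) x
          ≈⟨ *-congʳ (trans (prodL-cong (allFin n) at-u) (prodL-allFin-indicator u Φ)) ⟩
        Φ u * nodeFactor (deleteNode N u) x ∎
        where
        Φ : Fin n → Carrier
        Φ i = MRF.φ N i (x i)
        at-u : ∀ i → Φ i ^[ d i ∧ MRF.nodes N i ] ≈ Φ i ^[ d i ]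
        at-u i with i ≟ u
        ... | yes ≡.refl = ^[]-true u∈N
        ... | no  _      = refl

      private
        row-and-column : ∀ j e → isEdge N u j ≡ e →
          F u j ^[ lt u j ∧ e ] * F j u ^[ (lt j u ∧ isEdge N j u) ∧ not (d j) ] ≈ F u j ^[ e ]
        row-and-column j false e =
          trans (*-cong (^[]-false (∧-zeroʳ (lt u j))) (^[]-false other-side)) (*-identityˡ 1#)
          where
          other-side : (lt j u ∧ isEdge N j u) ∧ not (d j) ≡ false
          other-side = ≡.trans (≡.cong (λ b → (lt j u ∧ b) ∧ not (d j)) (≡.trans (isEdge-sym simple j u) e))
                               (≡.cong (_∧ not (d j)) (∧-zeroʳ (lt j u)))
        row-and-column j true e =
          trans (*-cong (^[]-cong (∧-identityʳ (lt u j)) (λ _ → refl))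
                        (^[]-cong other-side (λ _ → IsSimple.f-sym simple j u _ _ e')))
                (^[]-not (lt u j) (F u j))
          where
          e' : isEdge N j u ≡ true
          e' = ≡.trans (isEdge-sym simple j u) e
          u≢j : ¬ u ≡ j
          u≢j ≡.refl = contradiction (≡.trans (≡.sym e) (isEdge-irrefl simple u)) (λ ())
          other-side : (lt j u ∧ isEdge N j u) ∧ not (d j) ≡ not (lt u j)
          other-side = ≡.trans (≡.cong₂ _∧_ (≡.trans (≡.cong (lt j u ∧_) e') (∧-identityʳ (lt j u)))
                                            (≡.cong not (dec-false (j ≟ u) (u≢j ∘ ≡.sym))))
                               (≡.trans (∧-identityʳ _) (<ᵇ-flip (u≢j ∘ toℕ-injective)))

      -- Every factor of edgeFactor N lies in row u, in column u, or in edgeFactor (deleteNode N u);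
      -- as f is symmetric, row and column together contribute each edge at u once (row-and-column).
      edgeFactor-deleteNode :
        edgeFactor N x ≈ prodL (allFin n) (λ j → F u j ^[ isEdge N u j ]) * edgeFactor (deleteNode N u) x
      edgeFactor-deleteNode = begin
        edgeFactor N x
          ≈⟨ prodL-cong (allFin n) (λ i → prodL-cong (allFin n) (λ j →
               trans (^[]-split (d i) (F i j)) (*-congˡ (^[]-split (d j) (F i j))))) ⟩
        prodL (allFin n) (λ i → prodL (allFin n) (λ j → inRow i j * (inColumn i j * offU i j)))
          ≈⟨ prodL-cong (allFin n) (λ i → trans (prodL-* (allFin n) _ _) (*-congˡ (prodL-* (allFin n) _ _))) ⟩
        prodL (allFin n) (λ i → prodL (allFin n) (inRow i)
                                * (prodL (allFin n) (inColumn i) * prodL (allFin n) (offU i)))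
          ≈⟨ trans (prodL-* (allFin n) _ _) (*-congˡ (prodL-* (allFin n) _ _)) ⟩
        prodL (allFin n) (λ i → prodL (allFin n) (inRow i))
          * (prodL (allFin n) (λ i → prodL (allFin n) (inColumn i))
             * prodL (allFin n) (λ i → prodL (allFin n) (offU i)))
          ≈⟨ *-cong rows≈row (*-congʳ columns≈column) ⟩
        prodL (allFin n) row * (prodL (allFin n) column * prodL (allFin n) (λ i → prodL (allFin n) (offU i)))
          ≈⟨ sym (*-assoc _ _ _) ⟩
        (prodL (allFin n) row * prodL (allFin n) column) * prodL (allFin n) (λ i → prodL (allFin n) (offU i))
          ≈⟨ *-cong (trans (sym (prodL-* (allFin n) row column))
                           (prodL-cong (allFin n) (λ j → row-and-column j _ ≡.refl)))
                    (prodL-cong (allFin n) (λ i → prodL-cong (allFin n) (λ j →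
                       ^[]-cong (rest i j) (λ _ → refl)))) ⟩
        prodL (allFin n) (λ j → F u j ^[ isEdge N u j ]) * edgeFactor (deleteNode N u) x ∎
        where
        E₀ : Fin n → Fin n → Bool
        E₀ i j = lt i j ∧ isEdge N i j
        inRow inColumn offU : Fin n → Fin n → Carrier
        inRow i j = F i j ^[ d i ∧ E₀ i j ]
        inColumn i j = F i j ^[ d j ∧ (E₀ i j ∧ not (d i)) ]
        offU i j = F i j ^[ (E₀ i j ∧ not (d i)) ∧ not (d j) ]
        row column : Fin n → Carrier
        row j = F u j ^[ E₀ u j ]
        column i = F i u ^[ E₀ i u ∧ not (d i) ]
        rows≈row : prodL (allFin n) (λ i → prodL (allFin n) (inRow i)) ≈ prodL (allFin n) row
        rows≈row = trans (prodL-cong (allFin n) (λ i →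
                         trans (prodL-cong (allFin n) (λ j → ^[]-∧ (d i) (F i j)))
                               (prodL-^[] (allFin n) (d i) _)))
                      (prodL-allFin-indicator u (λ i → prodL (allFin n) (λ j → F i j ^[ E₀ i j ])))
        columns≈column : prodL (allFin n) (λ i → prodL (allFin n) (inColumn i)) ≈ prodL (allFin n) column
        columns≈column = prodL-cong (allFin n) (λ i →
          trans (prodL-cong (allFin n) (λ j → ^[]-∧ (d j) (F i j)))
                (prodL-allFin-indicator u (λ j → F i j ^[ E₀ i j ∧ not (d i) ])))
        rest : ∀ i j → (E₀ i j ∧ not (d i)) ∧ not (d j) ≡ lt i j ∧ isEdge (deleteNode N u) i j
        rest i j = ≡.trans (∧-assoc (lt i j ∧ isEdge N i j) _ _)
                     (≡.trans (∧-assoc (lt i j) _ _)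
                       (≡.cong (lt i j ∧_) (≡.trans (≡.sym (∧-assoc (isEdge N i j) _ _))
                                                      (≡.sym (isEdge-deleteNode N u i j)))))

      weight-deleteNode : weight N x ≈ (MRF.φ N u (x u) * prodL (allFin n) (λ j → F u j ^[ isEdge N u j ]))
                                         * weight (deleteNode N u) x
      weight-deleteNode = begin
        weight N x                      ≈⟨ weight-factorises N x ⟩
        nodeFactor N x * edgeFactor N x ≈⟨ *-cong nodeFactor-deleteNode edgeFactor-deleteNode ⟩
        (MRF.φ N u (x u) * nodeFactor (deleteNode N u) x)
          * (prodL (allFin n) (λ j → F u j ^[ isEdge N u j ]) * edgeFactor (deleteNode N u) x)
                                        ≈⟨ *-interchange _ _ _ _ ⟩
        (MRF.φ N u (x u) * prodL (allFin n) (λ j → F u j ^[ isEdge N u j ]))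
          * (nodeFactor (deleteNode N u) x * edgeFactor (deleteNode N u) x)
                                        ≈⟨ *-congˡ (weight-factorises (deleteNode N u) x) ⟨
        (MRF.φ N u (x u) * prodL (allFin n) (λ j → F u j ^[ isEdge N u j ])) * weight (deleteNode N u) x ∎

    IsSimple-deleteNode : ∀ {N : MRF n q} u → IsSimple N → IsSimple (deleteNode N u)
    IsSimple-deleteNode {N} u simple = record
      { adj-sym    = adj-sym
      ; adj-irrefl = adj-irrefl
      ; f-sym      = λ i j a b e → f-sym i j a b (isEdge-deleteNode⇒ N u e)
      }
      where open IsSimple simple

    IsPositive-deleteNode : ∀ {N : MRF n q} u → IsPositive N → IsPositive (deleteNode N u)
    IsPositive-deleteNode {N} u positive = record
      { φ-pos = λ i a i∈ → φ-pos i a (∧-conicalˡ _ _ i∈)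
      ; f-pos = λ i j a b e → f-pos i j a b (isEdge-deleteNode⇒ N u e)
      }
      where open IsPositive positive

    IsSimple-condition : ∀ {N : MRF n q} acc → IsSimple N → IsSimple (condition N acc)
    IsSimple-condition {N} acc simple = record
      { adj-sym    = adj-sym
      ; adj-irrefl = adj-irrefl
      ; f-sym      = λ i j a b e → f-sym i j a b (isEdge-condition⇒ N acc e)
      }
      where open IsSimple simple

    IsPositive-condition : ∀ {N : MRF n q} acc → IsPositive N → IsPositive (condition N acc)
    IsPositive-condition {N} acc positive = record
      { φ-pos = λ i a i∈ → *-pos (φ-pos i a (∧-conicalˡ _ _ i∈))
                                 (prodL-pos acc (λ p → ^[]-pos _ (f-pos _ i _ a)))
      ; f-pos = λ i j a b e → f-pos i j a b (isEdge-condition⇒ N acc e)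
      }
      where open IsPositive positive

    -- φ and f are compared only where they enter the weight: conditioning changes φ off the nodes.
    infix 4 _≋_
    record _≋_ (N N' : MRF n q) : Set (c ⊔ ℓ₁) where
      field
        nodes-≡ : ∀ i → MRF.nodes N i ≡ MRF.nodes N' i
        adj-≡   : ∀ i j → MRF.adj N i j ≡ MRF.adj N' i j
        φ-≈     : ∀ i a → MRF.nodes N i ≡ true → MRF.φ N i a ≈ MRF.φ N' i a
        f-≈     : ∀ i j a b → isEdge N i j ≡ true → MRF.f N i j a b ≈ MRF.f N' i j a b

    weight-≋ : ∀ {N N' : MRF n q} → N ≋ N' → ∀ x → weight N x ≈ weight N' x
    weight-≋ {N} {N'} N≋N' x =
      weight-cong N N' nodes-≡ adj-≡ (λ i → φ-≈ i (x i)) (λ i j → f-≈ i j (x i) (x j))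
      where open _≋_ N≋N'

    nodeList-≋ : ∀ {N N' : MRF n q} → N ≋ N' → nodeList N ≡ nodeList N'
    nodeList-≋ N≋N' = filterᵇ-cong (_≋_.nodes-≡ N≋N') (allFin n)

    nodeList-deleteNode : ∀ (N : MRF n q) u → nodeList (deleteNode N u) ≡ nodeList N ∖ u
    nodeList-deleteNode N u = ≡.sym (filterᵇ-filterᵇ (MRF.nodes N) (λ j → not (does (j ≟ u))) (allFin n))

    ∈-nodeList : ∀ (N : MRF n q) {j} → MRF.nodes N j ≡ true → j ∈ nodeList N
    ∈-nodeList N j∈N = ∈-filter⁺ _ (∈-allFin _) (≡.subst T (≡.sym j∈N) _)

    nodeList-unique : ∀ (N : MRF n q) → Unique (nodeList N)
    nodeList-unique N = Unique-filter⁺ _ (allFin⁺ n)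

    memb-++ : ∀ w (xs ys : List (Fin n × Fin q)) → memb w (xs ++ ys) ≡ memb w xs ∨ memb w ys
    memb-++ w []       ys = ≡.refl
    memb-++ w (p ∷ xs) ys = ≡.trans (≡.cong (does (proj₁ p ≟ w) ∨_) (memb-++ w xs ys))
                                    (≡.sym (∨-assoc (does (proj₁ p ≟ w)) _ _))

    condition-[] : ∀ (N : MRF n q) → condition N [] ≋ N
    condition-[] N = record
      { nodes-≡ = λ i → ∧-identityʳ (MRF.nodes N i)
      ; adj-≡   = λ _ _ → ≡.refl
      ; φ-≈     = λ i a _ → *-identityʳ (MRF.φ N i a)
      ; f-≈     = λ _ _ _ _ _ → refl
      }

    condition-++ : ∀ (N : MRF n q) acc {u} a → MRF.nodes (condition N acc) u ≡ true →
                   condition (condition N acc) [ (u , a) ] ≋ condition N (acc ++ [ (u , a) ])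
    condition-++ N acc {u} a u∈ = record
      { nodes-≡ = nodes-≡
      ; adj-≡   = λ _ _ → ≡.refl
      ; φ-≈     = φ-≈
      ; f-≈     = λ _ _ _ _ _ → refl
      }
      where
      N₁ : MRF n q
      N₁ = condition N acc
      nodes-≡ : ∀ w → MRF.nodes (condition N₁ [ (u , a) ]) w ≡ MRF.nodes (condition N (acc ++ [ (u , a) ])) w
      nodes-≡ w = ≡.sym (≡.trans (≡.cong (λ m → MRF.nodes N w ∧ not m) (memb-++ w acc _))
                         (≡.trans (≡.cong (MRF.nodes N w ∧_) (deMorgan₂ ∨-∧-booleanAlgebra (memb w acc) _))
                                  (≡.sym (∧-assoc (MRF.nodes N w) _ _))))
      φ-≈ : ∀ w b → MRF.nodes (condition N₁ [ (u , a) ]) w ≡ true →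
            MRF.φ (condition N₁ [ (u , a) ]) w b ≈ MRF.φ (condition N (acc ++ [ (u , a) ])) w b
      φ-≈ w b w∈ = begin
        (MRF.φ N w b * prodL acc k) * (MRF.f N u w a b ^[ isEdge N₁ u w ] * 1#)
          ≈⟨ *-assoc _ _ _ ⟩
        MRF.φ N w b * (prodL acc k * (MRF.f N u w a b ^[ isEdge N₁ u w ] * 1#))
          ≈⟨ *-congˡ (*-congˡ (*-congʳ (reflexive (≡.cong (MRF.f N u w a b ^[_]) edge≡)))) ⟩
        MRF.φ N w b * (prodL acc k * prodL [ (u , a) ] k)
          ≈⟨ *-congˡ (prodL-++ acc _ k) ⟨
        MRF.φ N w b * prodL (acc ++ [ (u , a) ]) k ∎
        where
        k : Fin n × Fin q → Carrier
        k (u' , a') = MRF.f N u' w a' b ^[ isEdge N u' w ]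
        w∈N₁ : MRF.nodes N₁ w ≡ true
        w∈N₁ = ∧-conicalˡ _ _ w∈
        edge≡ : isEdge N₁ u w ≡ isEdge N u w
        edge≡ = ≡.trans (isEdge-on-nodes N₁ u∈ w∈N₁)
                        (≡.sym (isEdge-on-nodes N (∧-conicalˡ _ _ u∈) (∧-conicalˡ _ _ w∈N₁)))

    nodes-condition₁ : ∀ (N : MRF n q) u a w →
                       MRF.nodes (condition N [ (u , a) ]) w ≡ MRF.nodes (deleteNode N u) w
    nodes-condition₁ N u a w = ≡.cong (λ m → MRF.nodes N w ∧ not m)
      (≡.trans (∨-identityʳ _) (does-⇔ (mk⇔ ≡.sym ≡.sym) (u ≟ w) (w ≟ u)))

    nodeList-condition₁ : ∀ (N : MRF n q) u a → nodeList (condition N [ (u , a) ]) ≡ nodeList N ∖ u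
    nodeList-condition₁ N u a =
      ≡.trans (filterᵇ-cong (nodes-condition₁ N u a) (allFin n)) (nodeList-deleteNode N u)

    weight-condition₁ : ∀ {N : MRF n q} → IsSimple N → ∀ u a x →
      weight (condition N [ (u , a) ]) x
        ≈ weight (deleteNode N u) x * prodL (allFin n) (λ j → MRF.f N u j a (x j) ^[ isEdge N u j ])
    weight-condition₁ {N} simple u a x = begin
      weight N₁ x
        ≈⟨ weight-factorises N₁ x ⟩
      nodeFactor N₁ x * edgeFactor N₁ x
        ≈⟨ *-congʳ (prodL-cong (allFin n) (λ i → ^[]-* (MRF.nodes N₁ i) _ _)) ⟩
      prodL (allFin n) (λ i → MRF.φ N i (x i) ^[ MRF.nodes N₁ i ] * (g i * 1#) ^[ MRF.nodes N₁ i ])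
        * edgeFactor N₁ x
        ≈⟨ *-congʳ (prodL-* (allFin n) _ _) ⟩
      (prodL (allFin n) (λ i → MRF.φ N i (x i) ^[ MRF.nodes N₁ i ])
        * prodL (allFin n) (λ i → (g i * 1#) ^[ MRF.nodes N₁ i ])) * edgeFactor N₁ x
        ≈⟨ *-cong (*-cong (prodL-cong (allFin n) (λ i → ^[]-cong (nodes-condition₁ N u a i) (λ _ → refl)))
                          (prodL-cong (allFin n) (λ i → absorb i (isEdge N u i) ≡.refl)))
                  (edgeFactor-cong N₁ N₀ (nodes-condition₁ N u a) (λ _ _ → ≡.refl) (λ _ _ _ → refl)) ⟩
      (nodeFactor N₀ x * prodL (allFin n) g) * edgeFactor N₀ x
        ≈⟨ xy∙z≈xz∙y _ _ _ ⟩
      (nodeFactor N₀ x * edgeFactor N₀ x) * prodL (allFin n) g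
        ≈⟨ *-congʳ (weight-factorises N₀ x) ⟨
      weight N₀ x * prodL (allFin n) g ∎
      where
      N₀ N₁ : MRF n q
      N₀ = deleteNode N u
      N₁ = condition N [ (u , a) ]
      g : Fin n → Carrier
      g j = MRF.f N u j a (x j) ^[ isEdge N u j ]
      absorb : ∀ j e → isEdge N u j ≡ e → (MRF.f N u j a (x j) ^[ e ] * 1#) ^[ MRF.nodes N₁ j ]
                                            ≈ MRF.f N u j a (x j) ^[ e ]
      absorb j false _ = ^[]-one (MRF.nodes N₁ j) (*-identityˡ 1#)
      absorb j true  e = trans (^[]-true j∈N₁) (*-identityʳ _)
        where
        u≢j : ¬ u ≡ j
        u≢j ≡.refl = contradiction (≡.trans (≡.sym e) (isEdge-irrefl simple u)) (λ ())
        j∈N₁ : MRF.nodes N₁ j ≡ true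
        j∈N₁ = ≡.cong₂ (λ b m → b ∧ not (m ∨ false)) (isEdge⇒nodesʳ N e) (dec-false (u ≟ j) u≢j)

    weight-fix : ∀ {N : MRF n q} → IsSimple N → ∀ {u} → MRF.nodes N u ≡ true → ∀ {a x} → x u ≡ a →
                 weight N x ≈ MRF.φ N u a * weight (condition N [ (u , a) ]) x
    weight-fix {N} simple {u} u∈N {a} {x} xu≡a = begin
      weight N x
        ≈⟨ weight-deleteNode simple u∈N x ⟩
      (MRF.φ N u (x u) * prodL (allFin n) (λ j → MRF.f N u j (x u) (x j) ^[ isEdge N u j ]))
        * weight (deleteNode N u) x
        ≈⟨ *-congʳ (reflexive (≡.cong (λ b → MRF.φ N u b * prodL (allFin n) (λ j →
                                                  MRF.f N u j b (x j) ^[ isEdge N u j ])) xu≡a)) ⟩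
      (MRF.φ N u a * prodL (allFin n) (λ j → MRF.f N u j a (x j) ^[ isEdge N u j ]))
        * weight (deleteNode N u) x
        ≈⟨ xy∙z≈x∙zy _ _ _ ⟩
      MRF.φ N u a * (weight (deleteNode N u) x * prodL (allFin n) (λ j → MRF.f N u j a (x j) ^[ isEdge N u j ]))
        ≈⟨ *-congˡ (weight-condition₁ simple u a x) ⟨
      MRF.φ N u a * weight (condition N [ (u , a) ]) x ∎

    -- The base configuration only fills the coordinates off the node list; it is irrelevant (Z-rebase).
    Z : MRF n q → Cfg → Carrier
    Z N y = sumCfg (nodeList N) y (weight N)

    weightedSum : MRF n q → Cfg → (Cfg → Carrier) → Carrier
    weightedSum N y K = sumCfg (nodeList N) y (λ x → K x * weight N x)

    Z-rebase : ∀ (N : MRF n q) y y' → Z N y ≈ Z N y'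
    Z-rebase N y y' =
      sumCfg-rebase (nodeList N) (weight-local N) (λ j j∈N j∉ → contradiction (∈-nodeList N j∈N) j∉)

    Z-pos : ∀ {N : MRF n q} → IsPositive N → Fin q → ∀ y → 0# < Z N y
    Z-pos {N} positive a y = sumCfg-pos (nodeList N) y a (weight-pos positive)

    Z-≋ : ∀ {N N' : MRF n q} → N ≋ N' → ∀ y → Z N y ≈ Z N' y
    Z-≋ {N} {N'} N≋N' y = trans (sumCfg-cong (nodeList N) y (λ x _ → weight-≋ N≋N' x))
                                (reflexive (≡.cong (λ L → sumCfg L y (weight N')) (nodeList-≋ N≋N')))

    weightedSum-≋ : ∀ {N N' : MRF n q} → N ≋ N' → ∀ y K → weightedSum N y K ≈ weightedSum N' y K
    weightedSum-≋ {N} {N'} N≋N' y K =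
      trans (sumCfg-cong (nodeList N) y (λ x _ → *-congˡ (weight-≋ N≋N' x)))
            (reflexive (≡.cong (λ L → sumCfg L y (λ x → K x * weight N' x)) (nodeList-≋ N≋N')))

    weightedSum-fix : ∀ {N : MRF n q} → IsSimple N → ∀ {u} → MRF.nodes N u ≡ true → ∀ a y K →
      sumCfg (nodeList N ∖ u) (update y u a) (λ x → K x * weight N x)
        ≈ MRF.φ N u a * weightedSum (condition N [ (u , a) ]) (update y u a) K
    weightedSum-fix {N} simple {u} u∈N a y K = begin
      sumCfg (nodeList N ∖ u) (update y u a) (λ x → K x * weight N x)
        ≈⟨ sumCfg-cong (nodeList N ∖ u) _ (λ x x≡ →
             trans (*-congˡ (weight-fix simple u∈N (≡.trans (x≡ u (∉-∖ (nodeList N) u)) (update-same y u a))))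
                   (x∙yz≈y∙xz _ _ _)) ⟩
      sumCfg (nodeList N ∖ u) (update y u a) (λ x → MRF.φ N u a * (K x * weight N₁ x))
        ≈⟨ sumCfg-*ˡ (nodeList N ∖ u) _ _ _ ⟩
      MRF.φ N u a * sumCfg (nodeList N ∖ u) (update y u a) (λ x → K x * weight N₁ x)
        ≡⟨ ≡.cong (λ L → MRF.φ N u a * sumCfg L (update y u a) (λ x → K x * weight N₁ x))
                  (≡.sym (nodeList-condition₁ N u a)) ⟩
      MRF.φ N u a * weightedSum N₁ (update y u a) K ∎
      where
      N₁ : MRF n q
      N₁ = condition N [ (u , a) ]

    Z-Prob : ∀ {N : MRF n q} → IsSimple N → IsPositive N → ∀ {u} → MRF.nodes N u ≡ true → ∀ a y →
             Z N y * Prob N u a ≈ MRF.φ N u a * Z (condition N [ (u , a) ]) y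
    Z-Prob {N} simple positive {u} u∈N a y = begin
      Z N y * Prob N u a
        ≈⟨ *-congʳ (Z-rebase N y (const a)) ⟩
      Z N (const a)
        * (sumCfg (nodeList N) (const a) (λ x → if does (x u ≟ a) then weight N x else 0#) * Z N (const a) ⁻¹)
        ≈⟨ *-cancel-⁻¹ (pos⇒≉0 (Z-pos positive a (const a))) ⟩
      sumCfg (nodeList N) (const a) (λ x → if does (x u ≟ a) then weight N x else 0#)
        ≈⟨ sumCfg-indicator a (const a) (nodeList-unique N) (∈-nodeList N u∈N) (weight-ext N) ⟩
      sumCfg (nodeList N ∖ u) (update (const a) u a) (weight N)
        ≈⟨ sumCfg-cong (nodeList N ∖ u) _ (λ x _ → sym (*-identityˡ (weight N x))) ⟩
      sumCfg (nodeList N ∖ u) (update (const a) u a) (λ x → 1# * weight N x)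
        ≈⟨ weightedSum-fix simple u∈N a (const a) (λ _ → 1#) ⟩
      MRF.φ N u a * weightedSum N₁ (update (const a) u a) (λ _ → 1#)
        ≈⟨ *-congˡ (sumCfg-cong (nodeList N₁) _ (λ x _ → *-identityˡ (weight N₁ x))) ⟩
      MRF.φ N u a * Z N₁ (update (const a) u a)
        ≈⟨ *-congˡ (Z-rebase N₁ _ y) ⟩
      MRF.φ N u a * Z N₁ y ∎
      where
      N₁ : MRF n q
      N₁ = condition N [ (u , a) ]

    sumL-termProd-∷ : ∀ (N : MRF n q) v x0 acc u us →
      sumL (assignments (u ∷ us)) (termProd N v x0 acc)
        ≈ sumL (allFin q) (λ a → (MRF.f N v u x0 a * Prob (condition N acc) u a)
                                  * sumL (assignments us) (termProd N v x0 (acc ++ [ (u , a) ])))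
    sumL-termProd-∷ N v x0 acc u us =
      trans (sumL-concatMap (λ a → map ((u , a) ∷_) (assignments us)) (allFin q) _)
            (sumL-cong (allFin q) (λ a → trans (sumL-map ((u , a) ∷_) (assignments us) _)
                                               (sumL-*ˡ (assignments us) _ _)))

    weightedSum-chain : ∀ {N : MRF n q} → IsSimple N → IsPositive N → ∀ v x0 us acc y → Unique us →
      (∀ w → w ∈ us → MRF.nodes (condition N acc) w ≡ true) →
      weightedSum (condition N acc) y (λ x → prodL us (λ w → MRF.f N v w x0 (x w)))
        ≈ Z (condition N acc) y * sumL (assignments us) (termProd N v x0 acc)
    weightedSum-chain {N} _ _ v x0 [] acc y _ _ = begin
      weightedSum (condition N acc) y (λ _ → 1#)
        ≈⟨ sumCfg-cong (nodeList (condition N acc)) y (λ x _ → *-identityˡ _) ⟩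
      Z (condition N acc) y
        ≈⟨ *-identityʳ _ ⟨
      Z (condition N acc) y * 1#
        ≈⟨ *-congˡ (+-identityʳ 1#) ⟨
      Z (condition N acc) y * sumL (assignments []) (termProd N v x0 acc) ∎
    weightedSum-chain {N} simple positive v x0 (u ∷ us) acc y (u∉us ∷ unique) us⊆Nₐ = begin
      sumCfg (nodeList Nₐ) y (λ x → (h u (x u) * K x) * weight Nₐ x)
        ≈⟨ sumCfg-pick y (nodeList-unique Nₐ) (∈-nodeList Nₐ u∈Nₐ) integrand-ext ⟩
      sumL (allFin q) (λ a → sumCfg (nodeList Nₐ ∖ u) (update y u a) (λ x → (h u (x u) * K x) * weight Nₐ x))
        ≈⟨ sumL-cong (allFin q) clamp ⟩
      sumL (allFin q) (λ a → h u a * (MRF.φ Nₐ u a * (Z (Nₐ₊ a) (update y u a) * rest a)))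
        ≈⟨ sumL-cong (allFin q) (λ a → sym (regroup a)) ⟩
      sumL (allFin q) (λ a → Z Nₐ y * ((h u a * Prob Nₐ u a) * rest a))
        ≈⟨ sumL-*ˡ (allFin q) (Z Nₐ y) _ ⟩
      Z Nₐ y * sumL (allFin q) (λ a → (h u a * Prob Nₐ u a) * rest a)
        ≈⟨ *-congˡ (sumL-termProd-∷ N v x0 acc u us) ⟨
      Z Nₐ y * sumL (assignments (u ∷ us)) (termProd N v x0 acc) ∎
      where
      h : Fin n → Fin q → Carrier
      h w b = MRF.f N v w x0 b
      K : Cfg → Carrier
      K x = prodL us (λ w → h w (x w))
      Nₐ : MRF n q
      Nₐ = condition N acc
      Nₐ₊ : Fin q → MRF n q
      Nₐ₊ a = condition N (acc ++ [ (u , a) ])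
      rest : Fin q → Carrier
      rest a = sumL (assignments us) (termProd N v x0 (acc ++ [ (u , a) ]))
      u∈Nₐ : MRF.nodes Nₐ u ≡ true
      u∈Nₐ = us⊆Nₐ u (here ≡.refl)
      N≋ : ∀ a → condition Nₐ [ (u , a) ] ≋ Nₐ₊ a
      N≋ a = condition-++ N acc a u∈Nₐ
      us⊆Nₐ₊ : ∀ a w → w ∈ us → MRF.nodes (Nₐ₊ a) w ≡ true
      us⊆Nₐ₊ a w w∈us = ≡.trans (≡.sym (_≋_.nodes-≡ (N≋ a) w))
        (≡.cong₂ (λ b d → b ∧ not (d ∨ false)) (us⊆Nₐ w (there w∈us)) (dec-false (u ≟ w) (All.lookup u∉us w∈us)))
      K-ext : Extensional K
      K-ext z w z≡w = prodL-cong us (λ w' → reflexive (≡.cong (h w') (z≡w w' _)))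
      integrand-ext : Extensional (λ x → (h u (x u) * K x) * weight Nₐ x)
      integrand-ext z w z≡w =
        *-cong (*-cong (reflexive (≡.cong (h u) (z≡w u _))) (K-ext z w z≡w)) (weight-ext Nₐ z w z≡w)
      clamp : ∀ a → sumCfg (nodeList Nₐ ∖ u) (update y u a) (λ x → (h u (x u) * K x) * weight Nₐ x)
                    ≈ h u a * (MRF.φ Nₐ u a * (Z (Nₐ₊ a) (update y u a) * rest a))
      clamp a = begin
        sumCfg (nodeList Nₐ ∖ u) (update y u a) (λ x → (h u (x u) * K x) * weight Nₐ x)
          ≈⟨ sumCfg-cong (nodeList Nₐ ∖ u) _ (λ x x≡ →
               trans (*-assoc _ _ _) (*-congʳ (reflexive (≡.cong (h u)
                 (≡.trans (x≡ u (∉-∖ (nodeList Nₐ) u)) (update-same y u a)))))) ⟩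
        sumCfg (nodeList Nₐ ∖ u) (update y u a) (λ x → h u a * (K x * weight Nₐ x))
          ≈⟨ sumCfg-*ˡ (nodeList Nₐ ∖ u) _ _ _ ⟩
        h u a * sumCfg (nodeList Nₐ ∖ u) (update y u a) (λ x → K x * weight Nₐ x)
          ≈⟨ *-congˡ (weightedSum-fix (IsSimple-condition acc simple) u∈Nₐ a y K) ⟩
        h u a * (MRF.φ Nₐ u a * weightedSum (condition Nₐ [ (u , a) ]) (update y u a) K)
          ≈⟨ *-congˡ (*-congˡ (weightedSum-≋ (N≋ a) _ K)) ⟩
        h u a * (MRF.φ Nₐ u a * weightedSum (Nₐ₊ a) (update y u a) K)
          ≈⟨ *-congˡ (*-congˡ (weightedSum-chain simple positive v x0 us (acc ++ [ (u , a) ]) _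
                                                  unique (us⊆Nₐ₊ a))) ⟩
        h u a * (MRF.φ Nₐ u a * (Z (Nₐ₊ a) (update y u a) * rest a)) ∎
      regroup : ∀ a → Z Nₐ y * ((h u a * Prob Nₐ u a) * rest a)
                      ≈ h u a * (MRF.φ Nₐ u a * (Z (Nₐ₊ a) (update y u a) * rest a))
      regroup a = begin
        Z Nₐ y * ((h u a * Prob Nₐ u a) * rest a)
          ≈⟨ *-congˡ (*-assoc _ _ _) ⟩
        Z Nₐ y * (h u a * (Prob Nₐ u a * rest a))
          ≈⟨ x∙yz≈y∙xz _ _ _ ⟩
        h u a * (Z Nₐ y * (Prob Nₐ u a * rest a))
          ≈⟨ *-congˡ (*-assoc _ _ _) ⟨
        h u a * ((Z Nₐ y * Prob Nₐ u a) * rest a)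
          ≈⟨ *-congˡ (*-congʳ (Z-Prob (IsSimple-condition acc simple) (IsPositive-condition acc positive)
                                      u∈Nₐ a y)) ⟩
        h u a * ((MRF.φ Nₐ u a * Z (condition Nₐ [ (u , a) ]) y) * rest a)
          ≈⟨ *-congˡ (*-congʳ (*-congˡ (trans (Z-≋ (N≋ a) y) (Z-rebase (Nₐ₊ a) y _)))) ⟩
        h u a * ((MRF.φ Nₐ u a * Z (Nₐ₊ a) (update y u a)) * rest a)
          ≈⟨ *-congˡ (*-assoc _ _ _) ⟩
        h u a * (MRF.φ Nₐ u a * (Z (Nₐ₊ a) (update y u a) * rest a)) ∎

    sumCfg-fix-innerSum : ∀ {M : MRF n q} → IsSimple M → IsPositive M → ∀ {v} → MRF.nodes M v ≡ true →
      ∀ {vs} → Unique vs → (∀ u → u ∈ vs ⇔ (isEdge M v u ≡ true)) → ∀ a y →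
      sumCfg (nodeList M ∖ v) (update y v a) (weight M) ≈ Z (deleteNode M v) y * (MRF.φ M v a * innerSum M v vs a)
    sumCfg-fix-innerSum {M} simple positive {v} v∈M {vs} unique neighbours a y = begin
      sumCfg (nodeList M ∖ v) y' (weight M)
        ≈⟨ sumCfg-cong (nodeList M ∖ v) y' (λ x x≡ →
             weight-at-v x (≡.trans (x≡ v (∉-∖ (nodeList M) v)) (update-same y v a))) ⟩
      sumCfg (nodeList M ∖ v) y' (λ x → MRF.φ M v a * (K x * weight D x))
        ≈⟨ sumCfg-*ˡ (nodeList M ∖ v) y' _ _ ⟩
      MRF.φ M v a * sumCfg (nodeList M ∖ v) y' (λ x → K x * weight D x)
        ≡⟨ ≡.cong (λ L → MRF.φ M v a * sumCfg L y' (λ x → K x * weight D x)) (≡.sym (nodeList-deleteNode M v)) ⟩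
      MRF.φ M v a * weightedSum D y' K
        ≈⟨ *-congˡ (weightedSum-≋ (condition-[] D) y' K) ⟨
      MRF.φ M v a * weightedSum (condition D []) y' K
        ≈⟨ *-congˡ (weightedSum-chain (IsSimple-deleteNode v simple) (IsPositive-deleteNode v positive)
                                      v a vs [] y' unique vs⊆D) ⟩
      MRF.φ M v a * (Z (condition D []) y' * innerSum M v vs a)
        ≈⟨ *-congˡ (*-congʳ (trans (Z-≋ (condition-[] D) y') (Z-rebase D y' y))) ⟩
      MRF.φ M v a * (Z D y * innerSum M v vs a)
        ≈⟨ x∙yz≈y∙xz _ _ _ ⟩
      Z D y * (MRF.φ M v a * innerSum M v vs a) ∎
      where
      D : MRF n q
      D = deleteNode M v
      y' : Cfg
      y' = update y v a
      K : Cfg → Carrier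
      K x = prodL vs (λ w → MRF.f M v w a (x w))
      weight-at-v : ∀ x → x v ≡ a → weight M x ≈ MRF.φ M v a * (K x * weight D x)
      weight-at-v x xv≡a = begin
        weight M x
          ≈⟨ weight-fix simple v∈M xv≡a ⟩
        MRF.φ M v a * weight (condition M [ (v , a) ]) x
          ≈⟨ *-congˡ (weight-condition₁ simple v a x) ⟩
        MRF.φ M v a * (weight D x * prodL (allFin n) (λ j → MRF.f M v j a (x j) ^[ isEdge M v j ]))
          ≈⟨ *-congˡ (*-comm _ _) ⟩
        MRF.φ M v a * (prodL (allFin n) (λ j → MRF.f M v j a (x j) ^[ isEdge M v j ]) * weight D x)
          ≈⟨ *-congˡ (*-congʳ (prodL-enumerates (isEdge M v) _ unique neighbours)) ⟨
        MRF.φ M v a * (K x * weight D x) ∎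
      vs⊆D : ∀ w → w ∈ vs → MRF.nodes (condition D []) w ≡ true
      vs⊆D w w∈vs = ≡.cong₂ (λ b d → (b ∧ not d) ∧ true) (isEdge⇒nodesʳ M e) (dec-false (w ≟ v) w≢v)
        where
        e : isEdge M v w ≡ true
        e = to (neighbours w) w∈vs
        w≢v : ¬ w ≡ v
        w≢v ≡.refl = contradiction (≡.trans (≡.sym e) (isEdge-irrefl simple w)) λ ()

proposition6 : ∀ {c ℓ₁ ℓ₂} (F : OrderedField c ℓ₁ ℓ₂) →
    let open OrderedField F
        open MRFs F
    in ∀ {n q : ℕ} (M : MRF n q) → IsSimple M → IsPositive M →
       (v : Fin n) → MRF.nodes M v ≡ true →
       (vs : List (Fin n)) → Unique vs →
       (∀ u → (u ∈ vs) ⇔ (isEdge M v u ≡ true)) →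
       (x0 : Fin q) →
       Prob M v x0 ≈
         ((MRF.φ M v x0 * innerSum M v vs x0) *
          (sumL (allFin q) (λ x → MRF.φ M v x * innerSum M v vs x) ⁻¹))
proposition6 F {q = q} M simple positive v v∈M vs unique neighbours x0 = begin
  S * Z M (const x0) ⁻¹                   ≈⟨ *-cong S≈ (⁻¹-cong Z≈) ⟩
  (C * ρ x0) * (C * sumL (allFin q) ρ) ⁻¹ ≈⟨ *-cancelˡ-/ (pos⇒≉0 (<-respʳ-≈ Z≈ (Z-pos positive x0 (const x0)))) ⟩
  ρ x0 * sumL (allFin q) ρ ⁻¹             ∎
  where
  open OrderedField F
  open MRFs F
  open Properties F
  open import Relation.Binary.Reasoning.Setoid setoid
  open IsStrictTotalOrder <-isStrictTotalOrder using (<-respʳ-≈)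
  ρ : Fin q → Carrier
  ρ a = MRF.φ M v a * innerSum M v vs a
  C S : Carrier
  C = Z (deleteNode M v) (const x0)
  S = sumCfg (nodeList M) (const x0) (λ x → if does (x v ≟ x0) then weight M x else 0#)
  S≈ : S ≈ C * ρ x0
  S≈ = trans (sumCfg-indicator x0 (const x0) (nodeList-unique M) (∈-nodeList M v∈M) (weight-ext M))
             (sumCfg-fix-innerSum simple positive v∈M unique neighbours x0 (const x0))
  Z≈ : Z M (const x0) ≈ C * sumL (allFin q) ρ
  Z≈ = trans (sumCfg-pick (const x0) (nodeList-unique M) (∈-nodeList M v∈M) (weight-ext M))
             (trans (sumL-cong (allFin q) (λ a → sumCfg-fix-innerSum simple positive v∈M unique neighbours a (const x0)))
                    (sumL-*ˡ (allFin q) C ρ))
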